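{- Let $L \ge 1$ be an integer and let $r_0$ be a uniformly random integer in $[0, 2^L)$. Let $b_1, \ldots, b_k$ be positive integers with $b = \prod_{i=1}^k b_i \le 2^L$. For each $i$ from $1$ to $k$, define integers $a_i, r_i$ by the full-width product $b_i \otimes r_{i-1} = (a_i, r_i)$, i.e. $b_i r_{i-1} = 2^L a_i + r_i$ with $0 \le r_i < 2^L$ (so $a_i$ is the most significant $L$ bits and $r_i$ the least significant $L$ bits of the $2L$-bit product). Then, conditioned on the event $r_k \ge (2^L \bmod b)$, the values $a_1, \ldots, a_k$ are independent and uniformly random integers with $0 \le a_i < b_i$ for each $i$.
   Context: All numbers are non-negative integers. For integers $a,b$ with $b>0$, $a \bmod b = a - b\lfloor a/b\rfloor \in [0,b)$. The full-width multiplication $a \otimes c = (x, y)$ means $x, y$ are the integers with $2^L x + y = ac$ and $0 \le y < 2^L$. -}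

module Defs where

open import Data.Nat using (ℕ; zero; suc; _*_; _^_; _≤_; _≤?_)
open import Data.Nat.DivMod using (_/_; _%_)
open import Data.Nat.Properties using () renaming (_≟_ to _≟ℕ_)
open import Data.Vec using (Vec; []; _∷_; foldr)
open import Data.Vec.Properties using (≡-dec)
open import Data.List using (List; length; filter; upTo)
open import Data.Product using (_×_; _,_; proj₁; proj₂)
open import Relation.Nullary using (Dec; _×-dec_)
open import Relation.Binary.PropositionalEquality using (_≡_)

product : ∀ {k} → Vec ℕ k → ℕ
product []       = 1
product (c ∷ bs) = c * product bs

-- Total versions of ⌊a/d⌋ and a mod d (the value at d = 0 is irrelevant:
-- they are only used with d > 0, namely d = 2^L and d = b = ∏ bᵢ > 0).
div' : ℕ → ℕ → ℕ
div' a zero    = zero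
div' a (suc d) = a / suc d

mod' : ℕ → ℕ → ℕ
mod' a zero    = a
mod' a (suc d) = a % suc d

fullMul : (L c r : ℕ) → ℕ × ℕ
fullMul L c r = div' (c * r) (2 ^ L) , mod' (c * r) (2 ^ L)

steps : ∀ {k} (L : ℕ) → Vec ℕ k → ℕ → Vec ℕ k × ℕ
steps L []       r = [] , r
steps L (c ∷ bs) r with fullMul L c r
... | a , r′ with steps L bs r′
...   | as , rk = (a ∷ as) , rk

outputs : ∀ {k} (L : ℕ) → Vec ℕ k → ℕ → Vec ℕ k
outputs L bs r = proj₁ (steps L bs r)

final : ∀ {k} (L : ℕ) → Vec ℕ k → ℕ → ℕ
final L bs r = proj₂ (steps L bs r)

Event : ∀ {k} (L : ℕ) → Vec ℕ k → ℕ → Set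
Event L bs r = mod' (2 ^ L) (product bs) ≤ final L bs r

event? : ∀ {k} (L : ℕ) (bs : Vec ℕ k) (r : ℕ) → Dec (Event L bs r)
event? L bs r = mod' (2 ^ L) (product bs) ≤? final L bs r

countEvent : ∀ {k} (L : ℕ) → Vec ℕ k → ℕ
countEvent L bs = length (filter (event? L bs) (upTo (2 ^ L)))

countJoint : ∀ {k} (L : ℕ) → Vec ℕ k → Vec ℕ k → ℕ
countJoint L bs as =
  length (filter (λ r → event? L bs r ×-dec ≡-dec _≟ℕ_ (outputs L bs r) as) (upTo (2 ^ L)))

{-# OPTIONS --safe #-}
-- Unwinding the recursion gives r₀ b = 2^L E + rₖ with rₖ < 2^L, where E is the number with
-- mixed-radix digits a₁ … aₖ in the bases b₁ … bₖ; so (a₁, …, aₖ) is read off from E = ⌊r₀ b / 2^L⌋.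
-- Write 2^L = m + q b with m = 2^L mod b. Then rₖ ≥ m and E = A say exactly that r₀ b lies in
-- the window [A 2^L + m, (A + 1) 2^L), of length q b, which contains exactly q multiples of b.
-- Hence each of the b digit vectors is produced by exactly q of the b q values r₀ in the event.
module Submission where

open import Defs
open import Level using (Level)
open import Data.Nat using (ℕ; zero; suc; _+_; _*_; _^_; _≤_; _<_; _≤?_; _<?_; s≤s; z<s; >-nonZero)
open import Data.Nat.Properties
open import Data.Nat.DivMod using (_/_; _%_; m≡m%n+[m/n]*n; m%n<n; m/n*n≤m; m<n*o⇒m/o<n; m≥n⇒m/n>0)
open import Data.Nat.Tactic.RingSolver using (solve)
open import Data.List using (length; filter; applyUpTo)
open import Data.Vec using (Vec; []; _∷_; toList)
open import Data.Vec.Relation.Unary.All using (All; []; _∷_)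
open import Data.Vec.Relation.Binary.Pointwise.Inductive using (Pointwise; []; _∷_)
open import Data.Product using (_×_; _,_; ∃-syntax)
open import Function using (_∘_; id)
open import Function.Bundles using (_⇔_; mk⇔; Equivalence)
open import Function.Construct.Composition using (_⇔-∘_)
open import Relation.Unary using (Pred; Decidable; _∩_; ∁)
open import Relation.Unary.Properties using (_∩?_; ∁?)
open import Relation.Nullary using (yes; no; ¬_; contradiction)
open import Relation.Binary.PropositionalEquality

open Equivalence using (to; from)

private
  variable
    ℓ ℓ′ : Level
    P : Pred ℕ ℓ
    Q : Pred ℕ ℓ′

count : Decidable P → ℕ → ℕ
count P? zero = 0
count P? (suc n) with P? 0
... | yes _ = suc (count (P? ∘ suc) n)
... | no  _ = count (P? ∘ suc) n

length-filter-applyUpTo : (P? : Decidable P) (f : ℕ → ℕ) (n : ℕ) →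
  length (filter P? (applyUpTo f n)) ≡ count (P? ∘ f) n
length-filter-applyUpTo P? f zero = refl
length-filter-applyUpTo P? f (suc n) with P? (f 0)
... | yes _ = cong suc (length-filter-applyUpTo P? (f ∘ suc) n)
... | no  _ = length-filter-applyUpTo P? (f ∘ suc) n

count-cong : (P? : Decidable P) (Q? : Decidable Q) (n : ℕ) →
  (∀ r → r < n → P r ⇔ Q r) → count P? n ≡ count Q? n
count-cong P? Q? zero _ = refl
count-cong P? Q? (suc n) P⇔Q
  with P? 0 | Q? 0 | count-cong (P? ∘ suc) (Q? ∘ suc) n (λ r r<n → P⇔Q (suc r) (s≤s r<n))
... | yes _  | yes _ | ih = cong suc ih
... | no _   | no _  | ih = ih
... | yes p  | no ¬q | _  = contradiction (to (P⇔Q 0 z<s) p) ¬q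
... | no ¬p  | yes q | _  = contradiction (from (P⇔Q 0 z<s) q) ¬p

count-none : (P? : Decidable P) (n : ℕ) → (∀ r → r < n → ¬ P r) → count P? n ≡ 0
count-none P? zero _ = refl
count-none P? (suc n) ¬P with P? 0
... | yes p = contradiction p (¬P 0 z<s)
... | no _  = count-none (P? ∘ suc) n (λ r r<n → ¬P (suc r) (s≤s r<n))

count-all : (P? : Decidable P) (n : ℕ) → (∀ r → r < n → P r) → count P? n ≡ n
count-all P? zero _ = refl
count-all P? (suc n) allP with P? 0
... | yes _ = cong suc (count-all (P? ∘ suc) n (λ r r<n → allP (suc r) (s≤s r<n)))
... | no ¬p = contradiction (allP 0 z<s) ¬p

count-+ : (P? : Decidable P) (m n : ℕ) → count P? (m + n) ≡ count P? m + count (P? ∘ (m +_)) n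
count-+ P? zero n = refl
count-+ P? (suc m) n with P? 0
... | yes _ = cong suc (count-+ (P? ∘ suc) m n)
... | no  _ = count-+ (P? ∘ suc) m n

count-split : (P? : Decidable P) (Q? : Decidable Q) (n : ℕ) →
  count P? n ≡ count (P? ∩? Q?) n + count (P? ∩? ∁? Q?) n
count-split P? Q? zero = refl
count-split P? Q? (suc n) with P? 0 | Q? 0 | count-split (P? ∘ suc) (Q? ∘ suc) n
... | yes _ | yes _ | ih = cong suc ih
... | yes _ | no _  | ih = trans (cong suc ih) (sym (+-suc _ _))
... | no _  | _     | ih = ih

count-interval : {c q n : ℕ} → c + q ≤ n → count ((c ≤?_) ∩? (_<? c + q)) n ≡ q
count-interval {c} {q} c+q≤n with m≤n⇒∃[o]m+o≡n c+q≤n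
... | j , refl = begin
  count I? (c + q + j)                               ≡⟨ cong (count I?) (+-assoc c q j) ⟩
  count I? (c + (q + j))                             ≡⟨ count-+ I? c (q + j) ⟩
  count I? c + count (I? ∘ (c +_)) (q + j)           ≡⟨ cong₂ _+_ below (count-+ (I? ∘ (c +_)) q j) ⟩
  0 + (count (I? ∘ (c +_)) q + count (I? ∘ (c +_) ∘ (q +_)) j)
                                                     ≡⟨ cong₂ _+_ inside above ⟩
  q + 0                                              ≡⟨ +-identityʳ q ⟩
  q                                                  ∎
  where
  open ≡-Reasoning
  I? : Decidable (λ r → c ≤ r × r < c + q)
  I? = (c ≤?_) ∩? (_<? c + q)
  below : count I? c ≡ 0
  below = count-none I? c (λ r r<c (c≤r , _) → <⇒≱ r<c c≤r)
  inside : count (I? ∘ (c +_)) q ≡ q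
  inside = count-all (I? ∘ (c +_)) q (λ r r<q → m≤m+n c r , +-monoʳ-< c r<q)
  above : count (I? ∘ (c +_) ∘ (q +_)) j ≡ 0
  above = count-none (I? ∘ (c +_) ∘ (q +_)) j (λ r _ (_ , lt) → <⇒≱ lt (+-monoʳ-≤ c (m≤m+n q r)))

count-fibres : (P? : Decidable P) (f : ℕ → ℕ) (n b q : ℕ) →
  (∀ r → r < n → P r → f r < b) →
  (∀ A → A < b → count (P? ∩? λ r → f r ≟ A) n ≡ q) →
  count P? n ≡ b * q
count-fibres P? f n zero q range _ = count-none P? n (λ r r<n Pr → n≮0 (range r r<n Pr))
count-fibres {P = P} P? f n (suc b) q range fibre = begin
  count P? n                                           ≡⟨ count-split P? (λ r → f r ≟ b) n ⟩
  count (P? ∩? λ r → f r ≟ b) n + count P≢b? n        ≡⟨ cong₂ _+_ (fibre b ≤-refl) rest ⟩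
  q + b * q                                            ∎
  where
  open ≡-Reasoning
  P≢b? : Decidable (P ∩ ∁ (λ r → f r ≡ b))
  P≢b? = P? ∩? ∁? (λ r → f r ≟ b)
  drop-≢b : ∀ {A} → A < b → ∀ r → ((P r × f r ≢ b) × f r ≡ A) ⇔ (P r × f r ≡ A)
  drop-≢b A<b r = mk⇔ (λ ((Pr , _) , fr≡A) → Pr , fr≡A)
    (λ (Pr , fr≡A) → (Pr , λ fr≡b → <⇒≢ A<b (trans (sym fr≡A) fr≡b)) , fr≡A)
  rest : count P≢b? n ≡ b * q
  rest = count-fibres P≢b? f n b q
    (λ r r<n (Pr , fr≢b) → ≤∧≢⇒< (m<1+n⇒m≤n (range r r<n Pr)) fr≢b)
    (λ A A<b → trans (count-cong _ _ n (λ r _ → drop-≢b A<b r)) (fibre A (m<n⇒m<1+n A<b)))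

quotient-unique : ∀ {n x x' z} → x * n ≤ z → z < suc x * n → x' * n ≤ z → z < suc x' * n → x ≡ x'
quotient-unique {n} lo hi lo' hi' = ≤-antisym (below lo hi') (below lo' hi)
  where
  below : ∀ {a a' z} → a * n ≤ z → z < suc a' * n → a ≤ a'
  below lo hi = m<1+n⇒m≤n (*-cancelʳ-< n _ _ (≤-<-trans lo hi))

m*n+o<[1+m]*n : ∀ m {n o} → o < n → m * n + o < suc m * n
m*n+o<[1+m]*n m {n} o<n = <-≤-trans (+-monoʳ-< (m * n) o<n) (≤-reflexive (+-comm (m * n) n))

multiple-in-window : ∀ X b → 0 < b → ∃[ c ] (X ≤ c * b × c * b < b + X)
multiple-in-window X (suc b') _ = c , X≤cb , cb<b+X
  where
  open ≤-Reasoning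
  b c : ℕ
  b = suc b'
  c = (X + b') / b
  X≤cb : X ≤ c * b
  X≤cb = +-cancelʳ-≤ b' X (c * b) (begin
    X + b'                  ≡⟨ m≡m%n+[m/n]*n (X + b') b ⟩
    (X + b') % b + c * b    ≤⟨ +-monoˡ-≤ (c * b) (m<1+n⇒m≤n (m%n<n (X + b') b)) ⟩
    b' + c * b              ≡⟨ +-comm b' (c * b) ⟩
    c * b + b'              ∎)
  cb<b+X : c * b < b + X
  cb<b+X = begin-strict
    c * b                   ≤⟨ m/n*n≤m (X + b') b ⟩
    X + b'                  ≡⟨ +-comm X b' ⟩
    b' + X                  <⟨ n<1+n (b' + X) ⟩
    b + X                   ∎

count-multiples : (P? : Decidable P) (n : ℕ) {X Y b q : ℕ} → 0 < b → X + q * b ≡ Y → Y ≤ n * b →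
  (∀ r → r < n → P r ⇔ (X ≤ r * b × r * b < Y)) → count P? n ≡ q
count-multiples P? n {X} {b = b} {q} b>0 refl Y≤nb P⇔window with multiple-in-window X b b>0
... | c , X≤cb , cb<b+X =
  trans (count-cong P? I? n (λ r r<n → window⇔interval r ⇔-∘ P⇔window r r<n)) (count-interval c+q≤n)
  where
  open ≤-Reasoning
  I? : Decidable (λ r → c ≤ r × r < c + q)
  I? = (c ≤?_) ∩? (_<? c + q)

  X≤multiple : ∀ {r} → c ≤ r → X ≤ r * b
  X≤multiple c≤r = ≤-trans X≤cb (*-monoˡ-≤ b c≤r)

  multiple<X : ∀ {r} → r < c → r * b < X
  multiple<X r<c = +-cancelˡ-< b _ _ (≤-<-trans (*-monoˡ-≤ b r<c) cb<b+X)

  Y≤multiple : ∀ {r} → c + q ≤ r → X + q * b ≤ r * b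
  Y≤multiple {r} c+q≤r = begin
    X + q * b                        ≤⟨ +-monoˡ-≤ (q * b) X≤cb ⟩
    c * b + q * b                    ≡⟨ *-distribʳ-+ b c q ⟨
    (c + q) * b                      ≤⟨ *-monoˡ-≤ b c+q≤r ⟩
    r * b                            ∎

  multiple<Y : ∀ {r} → r < c + q → r * b < X + q * b
  multiple<Y {r} r<c+q = +-cancelˡ-< b _ _ (begin-strict
    b + r * b                        ≤⟨ *-monoˡ-≤ b r<c+q ⟩
    (c + q) * b                      ≡⟨ *-distribʳ-+ b c q ⟩
    c * b + q * b                    <⟨ +-monoˡ-< (q * b) cb<b+X ⟩
    b + X + q * b                    ≡⟨ +-assoc b X (q * b) ⟩
    b + (X + q * b)                  ∎)

  window⇔interval : ∀ r → (X ≤ r * b × r * b < X + q * b) ⇔ (c ≤ r × r < c + q)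
  window⇔interval r = mk⇔
    (λ (X≤rb , rb<Y) → ≮⇒≥ (λ r<c → <⇒≱ (multiple<X r<c) X≤rb)
                     , ≰⇒> (λ c+q≤r → <⇒≱ rb<Y (Y≤multiple c+q≤r)))
    (λ (c≤r , r<c+q) → X≤multiple c≤r , multiple<Y r<c+q)

  c+q≤n : c + q ≤ n
  c+q≤n = ≮⇒≥ (λ n<c+q → <⇒≱ (multiple<Y n<c+q) Y≤nb)

m≡mod'+div'*n : ∀ m {n} → 0 < n → m ≡ mod' m n + div' m n * n
m≡mod'+div'*n m {suc n} _ = m≡m%n+[m/n]*n m (suc n)

mod'<n : ∀ m {n} → 0 < n → mod' m n < n
mod'<n m {suc n} _ = m%n<n m (suc n)

div'<o : ∀ {m n o} → 0 < n → m < o * n → div' m n < o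
div'<o {n = suc n} _ = m<n*o⇒m/o<n

div'>0 : ∀ {m n} → 0 < n → n ≤ m → 0 < div' m n
div'>0 {n = suc n} _ = m≥n⇒m/n>0

mixedRadix : ∀ {k} → Vec ℕ k → Vec ℕ k → ℕ
mixedRadix []       []       = 0
mixedRadix (_ ∷ bs) (a ∷ as) = a * product bs + mixedRadix bs as

mixedRadix<product : ∀ {k} {bs as : Vec ℕ k} → Pointwise _<_ as bs → mixedRadix bs as < product bs
mixedRadix<product []                            = z<s
mixedRadix<product {bs = _ ∷ bs} {a ∷ _} (a<c ∷ as<bs) =
  <-≤-trans (m*n+o<[1+m]*n a (mixedRadix<product as<bs)) (*-monoˡ-≤ (product bs) a<c)

mixedRadix-injective : ∀ {k} {bs as as' : Vec ℕ k} → Pointwise _<_ as bs → Pointwise _<_ as' bs →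
  mixedRadix bs as ≡ mixedRadix bs as' → as ≡ as'
mixedRadix-injective [] [] _ = refl
mixedRadix-injective {bs = _ ∷ bs} {a ∷ as} {a' ∷ as'} (_ ∷ as<bs) (_ ∷ as'<bs) eq =
  cong₂ _∷_ a≡a' (mixedRadix-injective as<bs as'<bs (+-cancelˡ-≡ (a * product bs) _ _ eq'))
  where
  a≡a' : a ≡ a'
  a≡a' = quotient-unique (m≤m+n (a * product bs) _) (m*n+o<[1+m]*n a (mixedRadix<product as<bs))
    (subst (a' * product bs ≤_) (sym eq) (m≤m+n (a' * product bs) _))
    (subst (_< suc a' * product bs) (sym eq) (m*n+o<[1+m]*n a' (mixedRadix<product as'<bs)))
  eq' : a * product bs + mixedRadix bs as ≡ a * product bs + mixedRadix bs as'
  eq' = trans eq (cong (λ x → x * product bs + mixedRadix bs as') (sym a≡a'))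

product>0 : ∀ {k} {bs : Vec ℕ k} → All (0 <_) bs → 0 < product bs
product>0 []           = z<s
product>0 (c>0 ∷ bs>0) = *-mono-< c>0 (product>0 bs>0)

carry-step : ∀ {r c B r' a N E F} → c * r ≡ r' + a * N → r' * B ≡ E * N + F →
  r * (c * B) ≡ (a * B + E) * N + F
carry-step {r} {c} {B} {r'} {a} {N} {E} {F} cr≡r'+aN r'B≡EN+F = begin
  r * (c * B)              ≡⟨ solve (toList (r ∷ c ∷ B ∷ [])) ⟩
  c * r * B                ≡⟨ cong (_* B) cr≡r'+aN ⟩
  (r' + a * N) * B         ≡⟨ solve (toList (r' ∷ a ∷ N ∷ B ∷ [])) ⟩
  r' * B + a * B * N       ≡⟨ cong (_+ a * B * N) r'B≡EN+F ⟩
  E * N + F + a * B * N    ≡⟨ solve (toList (E ∷ N ∷ F ∷ a ∷ B ∷ [])) ⟩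
  (a * B + E) * N + F      ∎
  where open ≡-Reasoning

module _ (L : ℕ) where
  private
    N : ℕ
    N = 2 ^ L
    N>0 : 0 < N
    N>0 = m^n>0 2 L

  steps-invariant : ∀ {k} (bs : Vec ℕ k) r →
    r * product bs ≡ mixedRadix bs (outputs L bs r) * N + final L bs r
  steps-invariant []       r = *-identityʳ r
  steps-invariant (c ∷ bs) r =
    carry-step {r} {c} {r' = mod' (c * r) N} {div' (c * r) N}
      (m≡mod'+div'*n (c * r) N>0) (steps-invariant bs _)

  final<2^L : ∀ {k} (bs : Vec ℕ k) {r} → r < N → final L bs r < N
  final<2^L []       r<N = r<N
  final<2^L (c ∷ bs) _   = final<2^L bs (mod'<n (c * _) N>0)

  outputs<bs : ∀ {k} {bs : Vec ℕ k} {r} → All (0 <_) bs → r < N → Pointwise _<_ (outputs L bs r) bs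
  outputs<bs []           _   = []
  outputs<bs {bs = c ∷ _} {r} (c>0 ∷ bs>0) r<N =
    div'<o N>0 (*-monoʳ-< c {{>-nonZero c>0}} r<N) ∷ outputs<bs bs>0 (mod'<n (c * r) N>0)

digit-window : ∀ {N m E F A z} → F < N → z ≡ E * N + F →
  (m ≤ F × E ≡ A) ⇔ (A * N + m ≤ z × z < suc A * N)
digit-window {N} {m} {E} {F} {A} F<N refl = mk⇔
  (λ { (m≤F , refl) → +-monoʳ-≤ (E * N) m≤F , m*n+o<[1+m]*n E F<N })
  (λ (lo , hi) →
    let E≡A = quotient-unique (m≤m+n (E * N) F) (m*n+o<[1+m]*n E F<N)
                              (≤-trans (m≤m+n (A * N) m) lo) hi
    in +-cancelˡ-≤ (A * N) m F (subst (λ x → A * N + m ≤ x * N + F) E≡A lo) , E≡A)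

module _ (L : ℕ) {k} (bs : Vec ℕ k) (bs>0 : All (0 <_) bs) where
  private
    N b q : ℕ
    N = 2 ^ L
    b = product bs
    q = div' N b
    b>0 : 0 < b
    b>0 = product>0 bs>0

  outputsValue : ℕ → ℕ
  outputsValue r = mixedRadix bs (outputs L bs r)

  count-event-fibre : ∀ {A} → A < b → count (event? L bs ∩? λ r → outputsValue r ≟ A) N ≡ q
  count-event-fibre {A} A<b = count-multiples _ N b>0 window-length window≤Nb
    (λ r r<N → digit-window (final<2^L L bs r<N) (steps-invariant L bs r))
    where
    open ≤-Reasoning
    window-length : A * N + mod' N b + q * b ≡ suc A * N
    window-length = begin-equality
      A * N + mod' N b + q * b       ≡⟨ +-assoc (A * N) _ _ ⟩
      A * N + (mod' N b + q * b)     ≡⟨ cong (A * N +_) (m≡mod'+div'*n N b>0) ⟨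
      A * N + N                      ≡⟨ +-comm (A * N) N ⟩
      suc A * N                      ∎
    window≤Nb : suc A * N ≤ N * b
    window≤Nb = begin
      suc A * N                      ≤⟨ *-monoˡ-≤ N A<b ⟩
      b * N                          ≡⟨ *-comm b N ⟩
      N * b                          ∎

  countEvent≡b*q : countEvent L bs ≡ b * q
  countEvent≡b*q = trans (length-filter-applyUpTo (event? L bs) id N)
    (count-fibres (event? L bs) outputsValue N b q
      (λ r r<N _ → mixedRadix<product (outputs<bs L bs>0 r<N)) (λ A A<b → count-event-fibre A<b))

  countJoint≡q : ∀ {as} → Pointwise _<_ as bs → countJoint L bs as ≡ q
  countJoint≡q {as} as<bs = trans (length-filter-applyUpTo _ id N)
    (trans (count-cong _ _ N joint⇔fibre) (count-event-fibre (mixedRadix<product as<bs)))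
    where
    joint⇔fibre : ∀ r → r < N →
      (Event L bs r × outputs L bs r ≡ as) ⇔ (Event L bs r × outputsValue r ≡ mixedRadix bs as)
    joint⇔fibre r r<N = mk⇔ (λ { (ev , refl) → ev , refl })
      (λ (ev , eq) → ev , mixedRadix-injective (outputs<bs L bs>0 r<N) as<bs eq)

  countJoint≡0 : ∀ {as} → ¬ Pointwise _<_ as bs → countJoint L bs as ≡ 0
  countJoint≡0 ¬as<bs = trans (length-filter-applyUpTo _ id N)
    (count-none _ N (λ { r r<N (_ , refl) → ¬as<bs (outputs<bs L bs>0 r<N) }))

theorem1 : (L k : ℕ) (bs : Vec ℕ k) → 1 ≤ L → All (0 <_) bs → product bs ≤ 2 ^ L →
    (0 < countEvent L bs)
    × ((as : Vec ℕ k) →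
        (Pointwise _<_ as bs → countJoint L bs as * product bs ≡ countEvent L bs)
        × (¬ Pointwise _<_ as bs → countJoint L bs as ≡ 0))
theorem1 L k bs _ bs>0 b≤N = countEvent>0 , λ as → countJoint*b≡countEvent , countJoint≡0 L bs bs>0
  where
  open ≡-Reasoning
  b q : ℕ
  b = product bs
  q = div' (2 ^ L) b
  countEvent>0 : 0 < countEvent L bs
  countEvent>0 = subst (0 <_) (sym (countEvent≡b*q L bs bs>0))
    (*-mono-< (product>0 bs>0) (div'>0 (product>0 bs>0) b≤N))
  countJoint*b≡countEvent : ∀ {as} → Pointwise _<_ as bs → countJoint L bs as * b ≡ countEvent L bs
  countJoint*b≡countEvent {as} as<bs = begin
    countJoint L bs as * b  ≡⟨ cong (_* b) (countJoint≡q L bs bs>0 as<bs) ⟩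
    q * b                   ≡⟨ *-comm q b ⟩
    b * q                   ≡⟨ countEvent≡b*q L bs bs>0 ⟨
    countEvent L bs         ∎
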